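{- Let $n\ge 3$ and let $a$ be an integer such that $S=\{r^af,f\}$ is a two-element symmetric generating set of $D_n$. Then (a) $\lambda_1(D_n,S)\le n$ and (b) $\lambda_2(D_n,S)\le 2$; furthermore $\lambda_1(D_n,S)=n$ if $n$ is odd and $\lambda_1(D_n,S)=n-1$ if $n$ is even.
   Context: The dihedral group $D_n$ is the group of order $2n$ with presentation $\langle r,f\mid r^n=f^2=1,\ rf=fr^{ -1}\rangle$. A subset $S$ of a group $G$ is a symmetric generating set if $S$ generates $G$, $1\notin S$, and $s\in S\Rightarrow s^{ -1}\in S$. For $g\in G$, $l_S(g)$ is the minimal number of factors in an expression of $g$ as a product of elements of $S$ ($l_S(1)=0$). Define $\lambda_1(G,S)=\max_{g\in G,\,s\in S} l_S(gsg^{ -1})$ and $\lambda_2(G,S)=\max_{g\in G,\,s,s'\in S} l_S(gss'g^{ -1})$. -}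

module Defs where

open import Data.Nat using (ℕ; zero; suc; _+_; _∸_; _≤_; NonZero)
open import Data.Nat.DivMod using (_mod_)
open import Data.Integer using (ℤ; _%ℕ_)
open import Data.Fin using (Fin; toℕ)
open import Data.Bool using (Bool; true; false; _xor_)
open import Data.List using (List; []; _∷_; length)
open import Data.List.Membership.Propositional using (_∈_; _∉_)
open import Data.Product using (Σ; _×_; _,_; ∃)
open import Relation.Binary.PropositionalEquality using (_≡_)

-- The dihedral group D_n of order 2n, in normal form r^k f^e
-- (k ∈ Z/n, e ∈ {0,1}; flip = true means e = 1).
record D (n : ℕ) : Set where
  constructor ⟨_,_⟩
  field
    rot  : Fin n
    flip : Bool
open D public

module _ {n : ℕ} .{{_ : NonZero n}} where

  rotℤ : ℤ → Fin n
  rotℤ a = (a %ℕ n) mod n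

  -- group operation, using f r^b = r^{-b} f :
  -- (r^k f^e)(r^b f^e') = r^{k ± b} f^{e+e'}
  _·_ : D n → D n → D n
  ⟨ k , false ⟩ · ⟨ b , e ⟩ = ⟨ (toℕ k + toℕ b) mod n , e ⟩
  ⟨ k , true  ⟩ · ⟨ b , e ⟩ = ⟨ (toℕ k + (n ∸ toℕ b)) mod n , e xor true ⟩

  one : D n
  one = ⟨ 0 mod n , false ⟩

  inv : D n → D n
  inv ⟨ k , false ⟩ = ⟨ (n ∸ toℕ k) mod n , false ⟩
  inv ⟨ k , true  ⟩ = ⟨ k , true ⟩

  r f : D n
  r = ⟨ 1 mod n , false ⟩
  f = ⟨ 0 mod n , true ⟩

  r^ : ℤ → D n
  r^ a = ⟨ rotℤ a , false ⟩

  prod : List (D n) → D n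
  prod []       = one
  prod (x ∷ xs) = x · prod xs

  data Word (S : List (D n)) : List (D n) → Set where
    []  : Word S []
    _∷_ : ∀ {x xs} → x ∈ S → Word S xs → Word S (x ∷ xs)

  IsSymGenSet : List (D n) → Set
  IsSymGenSet S =
    (∀ g → ∃ λ w → Word S w × prod w ≡ g) ×
    (one ∉ S) ×
    (∀ {s} → s ∈ S → inv s ∈ S)

  LenIs : List (D n) → D n → ℕ → Set
  LenIs S g m =
    (Σ (List (D n)) λ w → Word S w × prod w ≡ g × length w ≡ m) ×
    (∀ w → Word S w → prod w ≡ g → m ≤ length w)

  conj : D n → D n → D n
  conj g x = (g · x) · inv g

  λ₁≤ : List (D n) → ℕ → Set
  λ₁≤ S m = ∀ g s → s ∈ S → ∀ k → LenIs S (conj g s) k → k ≤ m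

  λ₁≡ : List (D n) → ℕ → Set
  λ₁≡ S m = λ₁≤ S m ×
    Σ (D n) λ g → Σ (D n) λ s → s ∈ S × LenIs S (conj g s) m

  λ₂≤ : List (D n) → ℕ → Set
  λ₂≤ S m = ∀ g s s' → s ∈ S → s' ∈ S → ∀ k → LenIs S (conj g (s · s')) k → k ≤ m

module Submission where

-- Word lengths in D_n for S = {s, t}, s = r^a f = r^α f, t = f; ρ(x) is the
-- rotation exponent of x.  Since S generates, α is a unit mod n.
-- Upper bounds: the alternating words (st)^c s and (ts)^d t (length 2c+1,
-- 2d+1) evaluate to r^{α(c+1)} f and r^{-αd} f, so the reflection
-- r^{α(c+1)} f with (c+1) + d = n has length ≤ min(2c+1, 2d+1); conjugates of
-- s, t are reflections.  For λ₂, ss' is a rotation by 0 or ±α, conjugation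
-- keeps or negates it, and 1, st = r^α, ts = r^{-α} have length ≤ 2.
-- Lower bound: a word of length m evaluates to r^{α(p-q)} f^e with p, q about
-- m/2 at most ('Shape'); cancelling α, r^{α(M+1)} f = (st)^M s needs 2M+1
-- letters when 2M+1 ≤ n, and it is a rotation-conjugate of s or t.

open import Defs
open import Data.Nat using (ℕ; _≤_; _∸_; NonZero)
open import Data.Nat.Divisibility using (_∣_)
open import Data.Integer using (ℤ)
open import Data.List using (List; []; _∷_)
open import Data.Product using (_×_)
open import Relation.Nullary using (¬_)
open import Relation.Binary.PropositionalEquality using (_≡_)

open import Data.Nat using (zero; suc; pred; _+_; _*_; _<_; z≤n; s≤s; _%_; _≤?_)
open import Data.Nat.Properties
  using ( ≤-refl; ≤-trans; ≤-reflexive; ≤-pred; m≤m+n; <⇒≤; ≮⇒≥; ≰⇒>; <-irrefl; n≤1+n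
        ; +-mono-≤; +-suc; +-assoc; +-comm; +-identityʳ; *-identityʳ; *-zeroʳ; *-suc
        ; *-comm; *-distribˡ-+; m+[n∸m]≡n; m∸n+n≡m; suc-pred; even≢odd; n≤0⇒n≡0 )
open import Data.Nat.DivMod
  using ( _mod_; %-distribˡ-+; %-distribˡ-*; m%n%n≡m%n; [m+n]%n≡m%n; m*n%n≡0
        ; m%n<n; m%n≤m; m<n⇒m%n≡m )
open import Data.Nat.Divisibility using (divides)
open import Data.Nat.Solver using (module +-*-Solver)
open import Data.Fin using (toℕ)
open import Data.Fin.Properties using (toℕ-injective; toℕ<n; toℕ-fromℕ<)
open import Data.Bool using (Bool; true; false; _xor_)
open import Data.List using (length)
open import Data.List.Relation.Unary.Any using (here; there)
open import Data.List.Membership.Propositional using (_∈_)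
open import Data.Product using (Σ; _,_; proj₁; proj₂)
open import Data.Sum using (_⊎_; inj₁; inj₂; reduce)
open import Relation.Nullary using (yes; no; contradiction)
open import Relation.Binary.PropositionalEquality
  using (refl; sym; trans; cong; cong₂; subst; module ≡-Reasoning)
open import Relation.Binary.Bundles using (Setoid)
import Relation.Binary.Reasoning.Setoid as SetoidReasoning
open import Level using (0ℓ)
open +-*-Solver using (solve; _:+_; _:*_; _:=_; con)

double-suc : ∀ m → suc m + suc m ≡ suc (suc (m + m))
double-suc m = cong suc (+-suc m m)

halve : ∀ m → Σ ℕ λ M → m ≡ M + M ⊎ m ≡ suc (M + M)
halve zero = 0 , inj₁ refl
halve (suc m) with halve m
... | M , inj₁ m≡ = M , inj₂ (cong suc m≡)
... | M , inj₂ m≡ = suc M , inj₁ (cong suc (trans m≡ (sym (+-suc M M))))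

smaller-half : ∀ {c d N} → c + d ≤ suc (N + N) → c ≤ N ⊎ d ≤ N
smaller-half {c} {d} {N} c+d≤ with c ≤? N
... | yes c≤N = inj₁ c≤N
... | no c≰N = inj₂ (≮⇒≥ λ N<d →
  <-irrefl refl (≤-trans (subst (_≤ c + d) (double-suc N) (+-mono-≤ (≰⇒> c≰N) N<d)) c+d≤))

-- Congruence modulo n.  It is a record so that both sides stay visible to
-- unification (x % n does not determine x).
module Congruence (n : ℕ) .{{_ : NonZero n}} where

  infix 4 _≈_
  record _≈_ (x y : ℕ) : Set where
    constructor mod≡
    field mod-eq : x % n ≡ y % n

  ≈-setoid : Setoid 0ℓ 0ℓ
  ≈-setoid = record
    { Carrier = ℕ
    ; _≈_ = _≈_
    ; isEquivalence = record
      { refl = mod≡ refl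
      ; sym = λ (mod≡ e) → mod≡ (sym e)
      ; trans = λ (mod≡ e) (mod≡ e′) → mod≡ (trans e e′)
      }
    }

  open Setoid ≈-setoid public using () renaming (refl to ≈-refl; sym to ≈-sym; trans to ≈-trans)
  module ≈-Reasoning = SetoidReasoning ≈-setoid

  ≡⇒≈ : ∀ {x y} → x ≡ y → x ≈ y
  ≡⇒≈ e = mod≡ (cong (_% n) e)

  %-≈ : ∀ x → x % n ≈ x
  %-≈ x = mod≡ (m%n%n≡m%n x n)

  +-cong : ∀ {a b c d} → a ≈ b → c ≈ d → a + c ≈ b + d
  +-cong {a} {b} {c} {d} (mod≡ a≈b) (mod≡ c≈d) = mod≡ (begin
    (a + c) % n          ≡⟨ %-distribˡ-+ a c n ⟩
    (a % n + c % n) % n  ≡⟨ cong₂ (λ x y → (x + y) % n) a≈b c≈d ⟩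
    (b % n + d % n) % n  ≡⟨ %-distribˡ-+ b d n ⟨
    (b + d) % n          ∎)
    where open ≡-Reasoning

  *-congˡ : ∀ c {a b} → a ≈ b → c * a ≈ c * b
  *-congˡ c {a} {b} (mod≡ a≈b) = mod≡ (begin
    (c * a) % n          ≡⟨ %-distribˡ-* c a n ⟩
    (c % n * (a % n)) % n ≡⟨ cong (λ x → (c % n * x) % n) a≈b ⟩
    (c % n * (b % n)) % n ≡⟨ %-distribˡ-* c b n ⟨
    (c * b) % n          ∎)
    where open ≡-Reasoning

  +n≈ : ∀ x → x + n ≈ x
  +n≈ x = mod≡ ([m+n]%n≡m%n x n)

  *n≈0 : ∀ k → k * n ≈ 0
  *n≈0 k = mod≡ (trans (m*n%n≡0 k n) (sym (n≤0⇒n≡0 (m%n≤m 0 n))))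

  +-≈0ʳ : ∀ {x y} → y ≈ 0 → x + y ≈ x
  +-≈0ʳ {x} y≈0 = ≈-trans (+-cong ≈-refl y≈0) (≡⇒≈ (+-identityʳ x))

  ≈⇒≡ : ∀ {x y} → x < n → y < n → x ≈ y → x ≡ y
  ≈⇒≡ x<n y<n (mod≡ e) = trans (sym (m<n⇒m%n≡m x<n)) (trans e (m<n⇒m%n≡m y<n))

  +-transpose : ∀ {a x b y} → a + x ≈ b → x + y ≈ 0 → a ≈ b + y
  +-transpose {a} {x} {b} {y} a+x≈b x+y≈0 = begin
    a            ≈⟨ +-≈0ʳ x+y≈0 ⟨
    a + (x + y)  ≡⟨ +-assoc a x y ⟨
    a + x + y    ≈⟨ +-cong a+x≈b ≈-refl ⟩
    b + y        ∎
    where open ≈-Reasoning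

  +-inverse : ∀ x → x + (n ∸ x % n) ≈ 0
  +-inverse x = begin
    x + (n ∸ x % n)      ≈⟨ +-cong (%-≈ x) ≈-refl ⟨
    x % n + (n ∸ x % n)  ≡⟨ m+[n∸m]≡n (<⇒≤ (m%n<n x n)) ⟩
    n                    ≈⟨ +n≈ 0 ⟩
    0                    ∎
    where open ≈-Reasoning

  +-cancelʳ : ∀ {a b x} → a + x ≈ b + x → a ≈ b
  +-cancelʳ {a} {b} {x} a+x≈b+x = begin
    a                  ≈⟨ +-transpose ≈-refl (+-inverse x) ⟩
    a + x + x′         ≈⟨ +-cong a+x≈b+x ≈-refl ⟩
    b + x + x′         ≈⟨ +-transpose ≈-refl (+-inverse x) ⟨
    b                  ∎
    where
      open ≈-Reasoning
      x′ : ℕ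
      x′ = n ∸ x % n

module Dihedral (n : ℕ) .{{_ : NonZero n}} where
  open Congruence n

  ρ : D n → ℕ
  ρ x = toℕ (rot x)

  ρ-mod : ∀ m → toℕ (m mod n) ≈ m
  ρ-mod m = ≈-trans (≡⇒≈ (toℕ-fromℕ< (m%n<n m n))) (%-≈ m)

  ρ-one : ρ one ≈ 0
  ρ-one = ρ-mod 0

  D-ext : ∀ {x y : D n} → ρ x ≈ ρ y → flip x ≡ flip y → x ≡ y
  D-ext {⟨ X , e ⟩} {⟨ Y , .e ⟩} ρx≈ρy refl =
    cong (λ k → ⟨ k , e ⟩) (toℕ-injective (≈⇒≡ (toℕ<n X) (toℕ<n Y) ρx≈ρy))

  rotation-· : ∀ K y → ρ (⟨ K , false ⟩ · y) ≈ toℕ K + ρ y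
  rotation-· K ⟨ B , _ ⟩ = ρ-mod (toℕ K + toℕ B)

  reflection-· : ∀ X y → ρ (⟨ X , true ⟩ · y) + ρ y ≈ toℕ X
  reflection-· X ⟨ B , _ ⟩ = begin
    toℕ ((toℕ X + (n ∸ toℕ B)) mod n) + toℕ B  ≈⟨ +-cong (ρ-mod _) ≈-refl ⟩
    toℕ X + (n ∸ toℕ B) + toℕ B               ≡⟨ +-assoc (toℕ X) _ _ ⟩
    toℕ X + (n ∸ toℕ B + toℕ B)               ≡⟨ cong (toℕ X +_) (m∸n+n≡m (<⇒≤ (toℕ<n B))) ⟩
    toℕ X + n                                 ≈⟨ +n≈ (toℕ X) ⟩
    toℕ X                                     ∎
    where open ≈-Reasoning

  reflection-shift : ∀ X y {c d} → ρ y + c ≈ d → ρ (⟨ X , true ⟩ · y) + d ≈ toℕ X + c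
  reflection-shift X y {c} {d} ρy+c≈d = begin
    ρ x·y + d          ≈⟨ +-cong ≈-refl ρy+c≈d ⟨
    ρ x·y + (ρ y + c)  ≡⟨ +-assoc (ρ x·y) (ρ y) c ⟨
    ρ x·y + ρ y + c    ≈⟨ +-cong (reflection-· X y) ≈-refl ⟩
    toℕ X + c          ∎
    where
      open ≈-Reasoning
      x·y : D n
      x·y = ⟨ X , true ⟩ · y

  reflection-pair : ∀ X Y y → ρ (⟨ X , true ⟩ · (⟨ Y , true ⟩ · y)) + toℕ Y ≈ toℕ X + ρ y
  reflection-pair X Y y = reflection-shift X (⟨ Y , true ⟩ · y) (reflection-· Y y)

  flip-pair : ∀ X Y y → flip (⟨ X , true ⟩ · (⟨ Y , true ⟩ · y)) ≡ flip y
  flip-pair X Y ⟨ _ , false ⟩ = refl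
  flip-pair X Y ⟨ _ , true ⟩ = refl

  rotation-inverse : ∀ K → ρ (inv ⟨ K , false ⟩) + toℕ K ≈ 0
  rotation-inverse K = begin
    toℕ ((n ∸ toℕ K) mod n) + toℕ K  ≈⟨ +-cong (ρ-mod (n ∸ toℕ K)) ≈-refl ⟩
    n ∸ toℕ K + toℕ K                ≡⟨ m∸n+n≡m (<⇒≤ (toℕ<n K)) ⟩
    n                                ≈⟨ +n≈ 0 ⟩
    0                                ∎
    where open ≈-Reasoning

  conj-reflection : ∀ g {x} → flip x ≡ true → flip (conj g x) ≡ true
  conj-reflection ⟨ _ , false ⟩ {⟨ _ , true ⟩} refl = refl
  conj-reflection ⟨ _ , true ⟩ {⟨ _ , true ⟩} refl = refl

  conj-rotation : ∀ g {x} → flip x ≡ false → flip (conj g x) ≡ false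
  conj-rotation ⟨ _ , false ⟩ {⟨ _ , false ⟩} refl = refl
  conj-rotation ⟨ _ , true ⟩ {⟨ _ , false ⟩} refl = refl

  rotation-conj-reflection : ∀ K {x} → flip x ≡ true → ρ (conj ⟨ K , false ⟩ x) ≈ toℕ K + ρ x + toℕ K
  rotation-conj-reflection K {⟨ X , true ⟩} refl = begin
    ρ c                        ≡⟨ +-identityʳ (ρ c) ⟨
    ρ c + 0                    ≈⟨ reflection-shift (rot gx) (inv ⟨ K , false ⟩) (rotation-inverse K) ⟩
    ρ gx + toℕ K               ≈⟨ +-cong (ρ-mod (toℕ K + toℕ X)) ≈-refl ⟩
    toℕ K + toℕ X + toℕ K      ∎
    where
      open ≈-Reasoning
      gx c : D n
      gx = ⟨ K , false ⟩ · ⟨ X , true ⟩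
      c = conj ⟨ K , false ⟩ ⟨ X , true ⟩

  rotation-conj-rotation : ∀ K Z → ρ (conj ⟨ K , false ⟩ ⟨ Z , false ⟩) ≈ toℕ Z
  rotation-conj-rotation K Z = begin
    ρ (conj g z)                         ≈⟨ rotation-· ((toℕ K + toℕ Z) mod n) (inv g) ⟩
    toℕ ((toℕ K + toℕ Z) mod n) + ρ g⁻¹  ≈⟨ +-cong (ρ-mod (toℕ K + toℕ Z)) ≈-refl ⟩
    toℕ K + toℕ Z + ρ g⁻¹                ≡⟨ cong (_+ ρ g⁻¹) (+-comm (toℕ K) (toℕ Z)) ⟩
    toℕ Z + toℕ K + ρ g⁻¹                ≡⟨ +-assoc (toℕ Z) (toℕ K) (ρ g⁻¹) ⟩
    toℕ Z + (toℕ K + ρ g⁻¹)              ≡⟨ cong (toℕ Z +_) (+-comm (toℕ K) (ρ g⁻¹)) ⟩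
    toℕ Z + (ρ g⁻¹ + toℕ K)              ≈⟨ +-≈0ʳ (rotation-inverse K) ⟩
    toℕ Z                                ∎
    where
      open ≈-Reasoning
      g z g⁻¹ : D n
      g = ⟨ K , false ⟩
      z = ⟨ Z , false ⟩
      g⁻¹ = inv g

  reflection-conj-rotation : ∀ K Z → ρ (conj ⟨ K , true ⟩ ⟨ Z , false ⟩) + toℕ Z ≈ 0
  reflection-conj-rotation K Z = +-cancelʳ (begin
    ρ c + toℕ Z + toℕ K  ≡⟨ +-assoc (ρ c) (toℕ Z) (toℕ K) ⟩
    ρ c + (toℕ Z + toℕ K) ≡⟨ cong (ρ c +_) (+-comm (toℕ Z) (toℕ K)) ⟩
    ρ c + (toℕ K + toℕ Z) ≡⟨ +-assoc (ρ c) (toℕ K) (toℕ Z) ⟨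
    ρ c + toℕ K + toℕ Z  ≈⟨ +-cong (reflection-· (rot gz) g) ≈-refl ⟩
    ρ gz + toℕ Z          ≈⟨ reflection-· K z ⟩
    toℕ K                 ∎)
    where
      open ≈-Reasoning
      g z gz c : D n
      g = ⟨ K , true ⟩
      z = ⟨ Z , false ⟩
      gz = g · z
      c = conj g z

  alternating : D n → D n → ℕ → List (D n)
  alternating x y zero = x ∷ []
  alternating x y (suc h) = x ∷ y ∷ alternating x y h

  alternating-word : ∀ {T x y} → x ∈ T → y ∈ T → ∀ h → Word T (alternating x y h)
  alternating-word x∈T y∈T zero = x∈T ∷ []
  alternating-word x∈T y∈T (suc h) = x∈T ∷ (y∈T ∷ alternating-word x∈T y∈T h)

  alternating-length : ∀ x y h → length (alternating x y h) ≡ suc (h + h)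
  alternating-length x y zero = refl
  alternating-length x y (suc h) =
    cong (λ k → suc (suc k)) (trans (alternating-length x y h) (sym (+-suc h h)))

  alternating-flip : ∀ X Y h → flip (prod (alternating ⟨ X , true ⟩ ⟨ Y , true ⟩ h)) ≡ true
  alternating-flip X Y zero = refl
  alternating-flip X Y (suc h) = trans (flip-pair X Y (prod (alternating ⟨ X , true ⟩ ⟨ Y , true ⟩ h))) (alternating-flip X Y h)

  Short : List (D n) → ℕ → D n → Set
  Short T b z = Σ (List (D n)) λ w → Word T w × prod w ≡ z × length w ≤ b

  LenIs-≤ : ∀ {T z k b} → LenIs T z k → Short T b z → k ≤ b
  LenIs-≤ (_ , minimal) (w , w∈T* , prod≡ , w≤b) = ≤-trans (minimal w w∈T* prod≡) w≤b

  λ₁≤-mono : ∀ {T b b′} → b ≤ b′ → λ₁≤ T b → λ₁≤ T b′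
  λ₁≤-mono b≤b′ bound g x x∈T k len = ≤-trans (bound g x x∈T k len) b≤b′

module Generators (n : ℕ) .{{_ : NonZero n}} (a : ℤ) where
  open Congruence n
  open Dihedral n

  s t : D n
  s = r^ a · f
  t = f

  S : List (D n)
  S = s ∷ t ∷ []

  s∈S : s ∈ S
  s∈S = here refl

  t∈S : t ∈ S
  t∈S = there (here refl)

  α : ℕ
  α = ρ s

  ρ-t : ρ t ≈ 0
  ρ-t = ρ-mod 0

  S-reflections : ∀ {x} → x ∈ S → flip x ≡ true
  S-reflections (here refl) = refl
  S-reflections (there (here refl)) = refl

  sAlt tAlt : ℕ → List (D n)
  sAlt = alternating s t
  tAlt = alternating t s

  st-value : ∀ y → ρ (s · (t · y)) ≈ α + ρ y
  st-value y = ≈-trans (≈-sym (+-≈0ʳ ρ-t)) (reflection-pair (rot s) (rot t) y)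

  ts-value : ∀ y → ρ (t · (s · y)) + α ≈ ρ y
  ts-value y = ≈-trans (reflection-pair (rot t) (rot s) y) (+-cong ρ-t ≈-refl)

  sAlt-value : ∀ h → ρ (prod (sAlt h)) ≈ α * suc h
  sAlt-value zero = begin
    ρ (s · one)          ≈⟨ +-≈0ʳ ρ-one ⟨
    ρ (s · one) + ρ one  ≈⟨ reflection-· (rot s) one ⟩
    α                    ≡⟨ *-identityʳ α ⟨
    α * 1                ∎
    where open ≈-Reasoning
  sAlt-value (suc h) = begin
    ρ (s · (t · prod (sAlt h)))  ≈⟨ st-value (prod (sAlt h)) ⟩
    α + ρ (prod (sAlt h))        ≈⟨ +-cong ≈-refl (sAlt-value h) ⟩
    α + α * suc h                ≡⟨ *-suc α (suc h) ⟨
    α * suc (suc h)              ∎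
    where open ≈-Reasoning

  tAlt-rotation : ∀ h → ρ (prod (tAlt h)) + α * h ≈ 0
  tAlt-rotation zero = begin
    ρ (t · one) + α * 0  ≡⟨ cong (ρ (t · one) +_) (*-zeroʳ α) ⟩
    ρ (t · one) + 0      ≈⟨ +-cong ≈-refl ρ-one ⟨
    ρ (t · one) + ρ one  ≈⟨ reflection-· (rot t) one ⟩
    ρ t                  ≈⟨ ρ-t ⟩
    0                    ∎
    where open ≈-Reasoning
  tAlt-rotation (suc h) = begin
    ρ tsP + α * suc h      ≡⟨ cong (ρ tsP +_) (*-suc α h) ⟩
    ρ tsP + (α + α * h)    ≡⟨ +-assoc (ρ tsP) α (α * h) ⟨
    ρ tsP + α + α * h      ≈⟨ +-cong (ts-value P) ≈-refl ⟩
    ρ P + α * h            ≈⟨ tAlt-rotation h ⟩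
    0                      ∎
    where
      open ≈-Reasoning
      P tsP : D n
      P = prod (tAlt h)
      tsP = t · (s · P)

  tAlt-value : ∀ c d → suc c + d ≡ n → ρ (prod (tAlt d)) ≈ α * suc c
  tAlt-value c d split = +-transpose (tAlt-rotation d) (begin
    α * d + α * suc c  ≡⟨ *-distribˡ-+ α d (suc c) ⟨
    α * (d + suc c)    ≡⟨ cong (α *_) (trans (+-comm d (suc c)) split) ⟩
    α * n              ≈⟨ *n≈0 α ⟩
    0                  ∎)
    where open ≈-Reasoning

  -- A word of length m evaluates to r^{α(p-q)} f^e where 2p and 2q are
  -- bounded by m (up to the parity correction e).
  HalfBounds : Bool → ℕ → ℕ → ℕ → Set
  HalfBounds false p q m = p + p ≤ m × q + q ≤ m
  HalfBounds true  p q m = p + p ≤ suc m × suc (q + q) ≤ m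

  halfBounds-step : ∀ {p q m} e → HalfBounds e p q m → HalfBounds (e xor true) (suc q) p (suc m)
  halfBounds-step {q = q} {m} false (p≤ , q≤) = subst (_≤ suc (suc m)) (sym (double-suc q)) (s≤s (s≤s q≤)) , s≤s p≤
  halfBounds-step {q = q} {m} true (p≤ , q<) = subst (_≤ suc m) (sym (double-suc q)) (s≤s q<) , p≤

  halfBounds-antitone : ∀ {p p′ q m} e → p′ ≤ p → HalfBounds e p q m → HalfBounds e p′ q m
  halfBounds-antitone false p′≤p (p≤ , q≤) = ≤-trans (+-mono-≤ p′≤p p′≤p) p≤ , q≤
  halfBounds-antitone true p′≤p (p≤ , q<) = ≤-trans (+-mono-≤ p′≤p p′≤p) p≤ , q<

  Shape : D n → ℕ → Set
  Shape y m = Σ ℕ λ p → Σ ℕ λ q → ρ y + α * q ≈ α * p × HalfBounds (flip y) p q m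

  -- Left multiplication by s maps r^{α(p-q)} to r^{α(q+1-p)}; by t to r^{α(q-p)}.
  shape-step : ∀ {x y m} → x ∈ S → Shape y m → Shape (x · y) (suc m)
  shape-step {y = y@(⟨ _ , e ⟩)} (here refl) (p , q , ρ≈ , bounds) =
    suc q , p , ≈-trans (reflection-shift (rot s) y ρ≈) (≡⇒≈ (sym (*-suc α q))) ,
    halfBounds-step e bounds
  shape-step {y = y@(⟨ _ , e ⟩)} (there (here refl)) (p , q , ρ≈ , bounds) =
    q , p , ≈-trans (reflection-shift (rot t) y ρ≈) (+-cong ρ-t ≈-refl) ,
    halfBounds-antitone (e xor true) (n≤1+n q) (halfBounds-step e bounds)

  word-shape : ∀ {w} → Word S w → Shape (prod w) (length w)
  word-shape [] = 0 , 0 , +-cong ρ-one ≈-refl , z≤n , z≤n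
  word-shape (x∈S ∷ w∈S*) = shape-step x∈S (word-shape w∈S*)

module Theory (n : ℕ) .{{_ : NonZero n}} (a : ℤ) (gen : IsSymGenSet ((r^ a · f) ∷ f ∷ [])) where
  open Congruence n
  open Dihedral n
  open Generators n a

  -- r is a word in S, so its shape gives 1 + αq ≈ αp, making α a unit.
  α-unit : Σ ℕ λ u → α * u ≈ 1
  α-unit with proj₁ gen r
  ... | w , w∈S* , w≡r with word-shape w∈S*
  ...   | p , q , ρw+αq≈αp , _ = p + q * pred n , (begin
    α * (p + q * pred n)        ≡⟨ solve 4 (λ α p q k → α :* (p :+ q :* k) := α :* p :+ (α :* q) :* k) refl α p q (pred n) ⟩
    α * p + α * q * pred n      ≈⟨ +-cong 1+αq≈αp ≈-refl ⟨
    1 + α * q + α * q * pred n  ≡⟨ solve 2 (λ x k → (con 1 :+ x) :+ x :* k := con 1 :+ x :* (con 1 :+ k)) refl (α * q) (pred n) ⟩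
    1 + α * q * suc (pred n)    ≡⟨ cong (λ k → 1 + α * q * k) (suc-pred n) ⟩
    1 + α * q * n               ≈⟨ +-≈0ʳ (*n≈0 (α * q)) ⟩
    1                           ∎)
    where
      open ≈-Reasoning
      1+αq≈αp : 1 + α * q ≈ α * p
      1+αq≈αp = ≈-trans (+-cong (≈-trans (≈-sym (ρ-mod 1)) (≡⇒≈ (cong ρ (sym w≡r)))) ≈-refl) ρw+αq≈αp

  α-injective : ∀ {x y} → α * x ≈ α * y → x ≈ y
  α-injective {x} {y} αx≈αy with α-unit
  ... | u , αu≈1 = begin
    x            ≡⟨ *-identityʳ x ⟨
    x * 1        ≈⟨ *-congˡ x αu≈1 ⟨
    x * (α * u)  ≡⟨ solve 3 (λ α u x → x :* (α :* u) := u :* (α :* x)) refl α u x ⟩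
    u * (α * x)  ≈⟨ *-congˡ u αx≈αy ⟩
    u * (α * y)  ≡⟨ solve 3 (λ α u y → u :* (α :* y) := y :* (α :* u)) refl α u y ⟩
    y * (α * u)  ≈⟨ *-congˡ y αu≈1 ⟩
    y * 1        ≡⟨ *-identityʳ y ⟩
    y            ∎
    where open ≈-Reasoning

  α-multiple : ∀ v → Σ ℕ λ c → c < n × α * suc c ≈ v
  α-multiple v with α-unit
  ... | u , αu≈1 = c , m%n<n _ n , (begin
    α * suc c                    ≈⟨ *-congˡ α (+-cong {1} ≈-refl (%-≈ (v * u + pred n))) ⟩
    α * suc (v * u + pred n)     ≡⟨ cong (α *_) (trans (sym (+-suc (v * u) (pred n))) (cong (v * u +_) (suc-pred n))) ⟩
    α * (v * u + n)              ≈⟨ *-congˡ α (+n≈ (v * u)) ⟩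
    α * (v * u)                  ≡⟨ solve 3 (λ α v u → α :* (v :* u) := v :* (α :* u)) refl α v u ⟩
    v * (α * u)                  ≈⟨ *-congˡ v αu≈1 ⟩
    v * 1                        ≡⟨ *-identityʳ v ⟩
    v                            ∎)
    where
      open ≈-Reasoning
      c : ℕ
      c = (v * u + pred n) % n

  -- Every split (c+1) + d = n offers (st)^c s or (ts)^d t of length ≤ b.
  SplitBound : ℕ → Set
  SplitBound b = ∀ c d → suc c + d ≡ n → suc (c + c) ≤ b ⊎ suc (d + d) ≤ b

  reflection-short : ∀ {b} → SplitBound b → ∀ z → flip z ≡ true → Short S b z
  reflection-short {b} split-bound z z-refl with α-multiple (ρ z)
  ... | c , c<n , αc≈ρz with split-bound c (n ∸ suc c) (m+[n∸m]≡n c<n)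
  ...   | inj₁ short = sAlt c , alternating-word s∈S t∈S c ,
    D-ext (≈-trans (sAlt-value c) αc≈ρz) (trans (alternating-flip (rot s) (rot t) c) (sym z-refl)) ,
    subst (_≤ b) (sym (alternating-length s t c)) short
  ...   | inj₂ short = tAlt d , alternating-word t∈S s∈S d ,
    D-ext (≈-trans (tAlt-value c d (m+[n∸m]≡n c<n)) αc≈ρz) (trans (alternating-flip (rot t) (rot s) d) (sym z-refl)) ,
    subst (_≤ b) (sym (alternating-length t s d)) short
    where
      d : ℕ
      d = n ∸ suc c

  -- Conjugates of s and t are reflections, hence of length ≤ b.
  λ₁-upper : ∀ {b} → SplitBound b → λ₁≤ S b
  λ₁-upper split-bound g x x∈S k len =
    LenIs-≤ len (reflection-short split-bound (conj g x) (conj-reflection g (S-reflections x∈S)))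

  SmallRot : ℕ → Set
  SmallRot v = v ≈ 0 ⊎ v ≈ α ⊎ v + α ≈ 0

  SmallRotation : D n → Set
  SmallRotation z = flip z ≡ false × SmallRot (ρ z)

  small-rotation-short : ∀ {z} → SmallRotation z → Short S 2 z
  small-rotation-short {z} (z-rot , inj₁ ρz≈0) =
    [] , [] , D-ext (≈-trans ρ-one (≈-sym ρz≈0)) (sym z-rot) , z≤n
  small-rotation-short {z} (z-rot , inj₂ (inj₁ ρz≈α)) =
    s ∷ t ∷ [] , s∈S ∷ (t∈S ∷ []) ,
    D-ext (≈-trans (≈-trans (st-value one) (+-≈0ʳ ρ-one)) (≈-sym ρz≈α)) (sym z-rot) , ≤-refl
  small-rotation-short {z} (z-rot , inj₂ (inj₂ ρz+α≈0)) =
    t ∷ s ∷ [] , t∈S ∷ (s∈S ∷ []) ,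
    D-ext (+-cancelʳ (≈-trans (≈-trans (ts-value one) ρ-one) (≈-sym ρz+α≈0))) (sym z-rot) , ≤-refl

  -- Conjugation fixes a rotation or inverts it; either way {0, α, -α} is preserved.
  conj-small-rotation : ∀ g {z} → SmallRotation z → SmallRotation (conj g z)
  conj-small-rotation g@(⟨ K , false ⟩) {⟨ Z , false ⟩} (refl , small) = conj-rotation g {⟨ Z , false ⟩} refl , fixed small
    where
      same : ρ (conj g ⟨ Z , false ⟩) ≈ toℕ Z
      same = rotation-conj-rotation K Z
      fixed : SmallRot (toℕ Z) → SmallRot (ρ (conj g ⟨ Z , false ⟩))
      fixed (inj₁ ≈0) = inj₁ (≈-trans same ≈0)
      fixed (inj₂ (inj₁ ≈α)) = inj₂ (inj₁ (≈-trans same ≈α))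
      fixed (inj₂ (inj₂ ≈-α)) = inj₂ (inj₂ (≈-trans (+-cong same ≈-refl) ≈-α))
  conj-small-rotation g@(⟨ K , true ⟩) {⟨ Z , false ⟩} (refl , small) = conj-rotation g {⟨ Z , false ⟩} refl , inverted small
    where
      opposite : ρ (conj g ⟨ Z , false ⟩) + toℕ Z ≈ 0
      opposite = reflection-conj-rotation K Z
      inverted : SmallRot (toℕ Z) → SmallRot (ρ (conj g ⟨ Z , false ⟩))
      inverted (inj₁ ≈0) = inj₁ (≈-trans (≈-sym (+-≈0ʳ ≈0)) opposite)
      inverted (inj₂ (inj₁ ≈α)) = inj₂ (inj₂ (≈-trans (+-cong ≈-refl (≈-sym ≈α)) opposite))
      inverted (inj₂ (inj₂ ≈-α)) = inj₂ (inj₁ (+-transpose opposite ≈-α))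

  product-small-rotation : ∀ {x y} → x ∈ S → y ∈ S → SmallRotation (x · y)
  product-small-rotation (here refl) (here refl) = refl , inj₁ (+-cancelʳ (reflection-· (rot s) s))
  product-small-rotation (here refl) (there (here refl)) =
    refl , inj₂ (inj₁ (≈-trans (≈-sym (+-≈0ʳ ρ-t)) (reflection-· (rot s) t)))
  product-small-rotation (there (here refl)) (here refl) =
    refl , inj₂ (inj₂ (≈-trans (reflection-· (rot t) s) ρ-t))
  product-small-rotation (there (here refl)) (there (here refl)) =
    refl , inj₁ (+-cancelʳ (reflection-· (rot t) t))

  -- Part (b): g s s' g⁻¹ is a conjugate of a small rotation.
  λ₂-bound : λ₂≤ S 2
  λ₂-bound g x y x∈S y∈S k len =
    LenIs-≤ len (small-rotation-short (conj-small-rotation g (product-small-rotation x∈S y∈S)))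

  -- A reflection r^{α(M+1)} f with 2M+1 ≤ n has no word shorter than 2M+1:
  -- a shorter word would have a shape with M+1+q ≡ p mod n, p ≤ M and
  -- M+1+q < n, which is impossible.
  reflection-long : ∀ M {z w} → suc (M + M) ≤ n → flip z ≡ true → ρ z ≈ α * suc M →
                    Word S w → prod w ≡ z → suc (M + M) ≤ length w
  reflection-long M {w = w} 2M<n z-refl ρz≈ w∈S* refl with word-shape w∈S*
  ... | p , q , ρw+αq≈αp , bounds = ≮⇒≥ too-short
    where
      p≤ : p + p ≤ suc (length w)
      p≤ = proj₁ (subst (λ e → HalfBounds e p q (length w)) z-refl bounds)
      q< : suc (q + q) ≤ length w
      q< = proj₂ (subst (λ e → HalfBounds e p q (length w)) z-refl bounds)
      M+1+q≈p : suc M + q ≈ p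
      M+1+q≈p = α-injective (≈-trans (≡⇒≈ (*-distribˡ-+ α (suc M) q))
                                     (≈-trans (+-cong (≈-sym ρz≈) ≈-refl) ρw+αq≈αp))
      too-short : ¬ (length w < suc (M + M))
      too-short w<2M+1 = <-irrefl refl (≤-trans (m≤m+n (suc M) q) (≤-trans (≤-reflexive M+1+q≡p) p≤M))
        where
          w≤2M : length w ≤ M + M
          w≤2M = ≤-pred w<2M+1
          p≤M : p ≤ M
          p≤M = reduce (smaller-half {p} {p} {M} (≤-trans p≤ (s≤s w≤2M)))
          q<M : suc q ≤ M
          q<M = reduce (smaller-half {suc q} {suc q} {M} (subst (_≤ suc (M + M)) (sym (double-suc q)) (s≤s (≤-trans q< w≤2M))))
          M+1+q<n : suc M + q < n
          M+1+q<n = ≤-trans (s≤s (subst (_≤ M + M) (+-suc M q) (+-mono-≤ (≤-refl {M}) q<M))) 2M<n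
          p<n : p < n
          p<n = ≤-trans (s≤s (≤-trans p≤M (m≤m+n M M))) 2M<n
          M+1+q≡p : suc M + q ≡ p
          M+1+q≡p = ≈⇒≡ M+1+q<n p<n M+1+q≈p

  sAlt-exact : ∀ M → suc (M + M) ≤ n → LenIs S (prod (sAlt M)) (suc (M + M))
  sAlt-exact M 2M<n =
    (sAlt M , alternating-word s∈S t∈S M , refl , alternating-length s t M) ,
    λ w w∈S* prod≡ → reflection-long M 2M<n (alternating-flip (rot s) (rot t) M) (sAlt-value M) w∈S* prod≡

  -- Conjugating x = r^{αe} f ∈ S by r^{αK} gives r^{α(2K+e)} f, which is
  -- (st)^M s when 2K + e = M + 1.
  conj-to-sAlt : ∀ M K e {x} → x ∈ S → ρ x ≈ α * e → K + e + K ≡ suc M →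
                 conj ⟨ (α * K) mod n , false ⟩ x ≡ prod (sAlt M)
  conj-to-sAlt M K e {x} x∈S ρx≈αe 2K+e≡M+1 = D-ext (begin
    ρ (conj g x)              ≈⟨ rotation-conj-reflection ((α * K) mod n) (S-reflections x∈S) ⟩
    ρ g + ρ x + ρ g           ≈⟨ +-cong (+-cong (ρ-mod (α * K)) ρx≈αe) (ρ-mod (α * K)) ⟩
    α * K + α * e + α * K     ≡⟨ solve 3 (λ α K e → α :* K :+ α :* e :+ α :* K := α :* (K :+ e :+ K)) refl α K e ⟩
    α * (K + e + K)           ≡⟨ cong (α *_) 2K+e≡M+1 ⟩
    α * suc M                 ≈⟨ sAlt-value M ⟨
    ρ (prod (sAlt M))         ∎)
    (trans (conj-reflection g (S-reflections x∈S)) (sym (alternating-flip (rot s) (rot t) M)))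
    where
      open ≈-Reasoning
      g : D n
      g = ⟨ (α * K) mod n , false ⟩

  -- Choose x = t if M+1 is even and x = s if M+1 is odd.
  sAlt-conjugate : ∀ M → Σ (D n) λ g → Σ (D n) λ x → x ∈ S × conj g x ≡ prod (sAlt M)
  sAlt-conjugate M with halve (suc M)
  ... | K , inj₁ M+1≡2K = ⟨ (α * K) mod n , false ⟩ , t , t∈S ,
    conj-to-sAlt M K 0 t∈S (≈-trans ρ-t (≡⇒≈ (sym (*-zeroʳ α))))
      (trans (cong (_+ K) (+-identityʳ K)) (sym M+1≡2K))
  ... | K , inj₂ M+1≡2K+1 = ⟨ (α * K) mod n , false ⟩ , s , s∈S ,
    conj-to-sAlt M K 1 s∈S (≡⇒≈ (sym (*-identityʳ α)))
      (trans (cong (_+ K) (+-comm K 1)) (sym M+1≡2K+1))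

  split-bound : ∀ N → n ≤ suc (suc (N + N)) → SplitBound (suc (N + N))
  split-bound N n≤ c d split with smaller-half {c} {d} {N} (≤-pred (≤-trans (≤-reflexive split) n≤))
  ... | inj₁ c≤N = inj₁ (s≤s (+-mono-≤ c≤N c≤N))
  ... | inj₂ d≤N = inj₂ (s≤s (+-mono-≤ d≤N d≤N))

  λ₁-exact : ∀ N → suc (N + N) ≤ n → n ≤ suc (suc (N + N)) → λ₁≡ S (suc (N + N))
  λ₁-exact N 2N<n n≤ with sAlt-conjugate N
  ... | g , x , x∈S , conj≡ =
    λ₁-upper (split-bound N n≤) , g , x , x∈S ,
    subst (λ z → LenIs S z (suc (N + N))) (sym conj≡) (sAlt-exact N 2N<n)

odd-or-even : ∀ n → 1 ≤ n → Σ ℕ λ N → n ≡ suc (N + N) ⊎ n ≡ suc (suc (N + N))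
odd-or-even (suc m) _ with halve m
... | N , inj₁ m≡2N = N , inj₁ (cong suc m≡2N)
... | N , inj₂ m≡2N+1 = N , inj₂ (cong suc m≡2N+1)

odd-not-even : ∀ N → ¬ (2 ∣ suc (N + N))
odd-not-even N (divides q 2N+1≡2q) =
  even≢odd q N (trans (*-comm 2 q) (trans (sym 2N+1≡2q) (cong (λ k → suc (N + k)) (sym (+-identityʳ N)))))

even-divisible : ∀ N → 2 ∣ suc (suc (N + N))
even-divisible N = divides (suc N) (solve 1 (λ N → con 2 :+ (N :+ N) := (con 1 :+ N) :* con 2) refl N)

theorem6 : (n : ℕ) .{{_ : NonZero n}} → 3 ≤ n → (a : ℤ) →
    let S = (r^ a · f) ∷ f ∷ [] in
    IsSymGenSet S → ¬ (r^ a · f ≡ f) →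
    λ₁≤ S n × λ₂≤ S 2 ×
    (¬ (2 ∣ n) → λ₁≡ S n) × (2 ∣ n → λ₁≡ S (n ∸ 1))
theorem6 n 3≤n a gen _ with odd-or-even n (≤-trans (s≤s z≤n) 3≤n)
... | N , inj₁ n≡2N+1 =
  λ₁≤-mono (≤-reflexive (sym n≡2N+1)) (proj₁ exact) , λ₂-bound ,
  (λ _ → subst (λ₁≡ S) (sym n≡2N+1) exact) ,
  (λ 2∣n → contradiction (subst (2 ∣_) n≡2N+1 2∣n) (odd-not-even N))
  where
    open Dihedral n using (λ₁≤-mono)
    open Generators n a using (S)
    open Theory n a gen using (λ₁-exact; λ₂-bound)
    exact : λ₁≡ S (suc (N + N))
    exact = λ₁-exact N (≤-reflexive (sym n≡2N+1)) (≤-trans (≤-reflexive n≡2N+1) (n≤1+n _))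
... | N , inj₂ n≡2N+2 =
  λ₁≤-mono (≤-trans (n≤1+n _) (≤-reflexive (sym n≡2N+2))) (proj₁ exact) , λ₂-bound ,
  (λ 2∤n → contradiction (subst (2 ∣_) (sym n≡2N+2) (even-divisible N)) 2∤n) ,
  (λ _ → subst (λ₁≡ S) (sym (cong (_∸ 1) n≡2N+2)) exact)
  where
    open Dihedral n using (λ₁≤-mono)
    open Generators n a using (S)
    open Theory n a gen using (λ₁-exact; λ₂-bound)
    exact : λ₁≡ S (suc (N + N))
    exact = λ₁-exact N (≤-trans (n≤1+n _) (≤-reflexive (sym n≡2N+2))) (≤-reflexive n≡2N+2)
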